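{- Fix a nonnegative integer $k$. The set of degree sequences of finite simple graphs with all degrees at most $k$ is well quasi ordered by $\preceq$; that is, for every infinite sequence $D_1, D_2, \ldots$ of degree sequences of finite simple graphs with all degrees at most $k$, there exist indices $i < j$ with $D_i \preceq D_j$.
   Context: The degree sequence $D(G)$ of a finite simple graph $G$ is the list of the degrees of all vertices of $G$ in decreasing order; a graph $G$ realizes $D$ if $D(G) = D$. For degree sequences $D_1, D_2$ of finite simple graphs, $D_1 \preceq D_2$ means there are graphs $G_1$ realizing $D_1$ and $G_2$ realizing $D_2$ such that $G_1$ is (isomorphic to) an induced subgraph of $G_2$. A quasi order is well quasi ordered if it has no infinite strictly decreasing sequence and no infinite antichain, equivalently if every infinite sequence $q_1,q_2,\ldots$ has $i<j$ with $q_i \le q_j$. -}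

module Defs where

open import Data.Nat using (ℕ; _≤_; _≥_; _<_)
open import Data.Fin using (Fin)
open import Data.Bool using (Bool; true; false; T)
open import Data.Bool.Properties using (T?)
open import Data.List using (List; length; filter; map; allFin)
open import Data.List.Relation.Unary.All using (All)
open import Data.List.Relation.Unary.Linked using (Linked)
open import Data.List.Relation.Binary.Permutation.Propositional using (_↭_)
open import Data.Product using (Σ; ∃; _×_)
open import Function.Definitions using (Injective)
open import Relation.Binary.PropositionalEquality using (_≡_)

record Graph (n : ℕ) : Set where
  field
    adj    : Fin n → Fin n → Bool
    sym    : ∀ u v → adj u v ≡ adj v u
    irrefl : ∀ v → adj v v ≡ false
open Graph public

degree : ∀ {n} → Graph n → Fin n → ℕ
degree {n} G v = length (filter (λ u → T? (adj G v u)) (allFin n))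

degrees : ∀ {n} → Graph n → List ℕ
degrees {n} G = map (degree G) (allFin n)

-- G realizes D  iff  D(G) = D, i.e. D is the list of degrees of G in
-- decreasing order: D is sorted non-increasingly and is a permutation of the degrees.
Realizes : ∀ {n} → Graph n → List ℕ → Set
Realizes G D = Linked _≥_ D × (D ↭ degrees G)

IsDegreeSequence : List ℕ → Set
IsDegreeSequence D = Σ ℕ λ n → Σ (Graph n) λ G → Realizes G D

InducedSubgraph : ∀ {m n} → Graph m → Graph n → Set
InducedSubgraph {m} {n} G₁ G₂ =
  Σ (Fin m → Fin n) λ f → Injective _≡_ _≡_ f × (∀ u v → adj G₁ u v ≡ adj G₂ (f u) (f v))

_⪯_ : List ℕ → List ℕ → Set
D₁ ⪯ D₂ = Σ ℕ λ m → Σ ℕ λ n → Σ (Graph m) λ G₁ → Σ (Graph n) λ G₂ →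
  Realizes G₁ D₁ × Realizes G₂ D₂ × InducedSubgraph G₁ G₂

module Submission where

-- For degree sequences bounded by k, call D' an extension of D if, for every d ≤ k, D' has at
-- least as many entries d as D and the surplus is a multiple of d + 1. Then D ⪯ D': adding the
-- right number of disjoint copies of K_{d+1} to a realisation G of D gives a realisation of D'
-- in which G is an induced subgraph. Comparing quotient and remainder of the counts modulo d + 1,
-- extension is a finite intersection of pullbacks of ≤ on ℕ, so it is well quasi ordered by
-- the intersection theorem for almost-full relations (constructive Ramsey).

open import Defs
open import Data.Bool using (Bool; true; false; not; if_then_else_)
open import Data.Bool.Properties using (T?)
open import Data.Empty using (⊥-elim)
open import Data.Fin using (Fin; zero; suc; _↑ˡ_; _↑ʳ_; splitAt)
open import Data.Fin.Properties using (splitAt-↑ˡ; splitAt-↑ʳ; ↑ˡ-injective) renaming (_≟_ to _≟ᶠ_)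
open import Data.List using (List; []; _∷_; [_]; _++_; length; filter; tabulate)
open import Data.List.Properties using (length-++; length-map; length-tabulate; filter-++; filter-accept; filter-reject; filter-all; filter-none; map-tabulate; tabulate-cong)
open import Data.List.Relation.Unary.All using (All)
import Data.List.Relation.Unary.All as All
open import Data.List.Relation.Unary.All.Properties using (++⁺; tabulate⁺)
open import Data.List.Relation.Unary.Linked using (Linked)
open import Data.List.Relation.Binary.Permutation.Propositional using (_↭_; ↭-refl; ↭-prep; ↭-swap; ↭-trans; ↭-sym)
open import Data.List.Relation.Binary.Permutation.Propositional.Properties using (↭-length; filter-↭)
open import Data.Nat using (ℕ; zero; suc; _+_; _*_; _∸_; _≤_; _<_; _≥_; _≤?_; _<?_; z≤n; s≤s; NonZero)
open import Data.Nat.DivMod using (_/_; _%_; m≡m%n+[m/n]*n; m%n<n)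
open import Data.Nat.Properties using (_≟_; ≤-refl; ≤-trans; ≤-antisym; <⇒≤; <⇒≢; ≤-<-trans; ≮⇒≥; ≰⇒>; +-assoc; +-identityʳ; +-cancelˡ-≡; 0≢1+n; *-distribʳ-+; m+[n∸m]≡n; ∸-cancelʳ-≤; m<1+n⇒m<n∨m≡n)
open import Data.Product using (Σ; _×_; _,_)
open import Data.Sum using (_⊎_; inj₁; inj₂; map₁)
open import Function using (_∘_; _∘′_; _on_; id)
open import Level using (0ℓ)
open import Relation.Binary.Core using (Rel; _⇒_)
open import Relation.Binary.Construct.Constant.Core using (Const)
open import Relation.Binary.Construct.Intersection using (_∩_)
open import Relation.Binary.Construct.Never using (Never)
open import Relation.Binary.Construct.Union using (_∪_)
import Relation.Binary.PropositionalEquality as ≡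
open import Relation.Binary.PropositionalEquality using (_≡_; _≢_; refl; trans; cong; cong₂; subst; _≗_; module ≡-Reasoning)
open import Relation.Nullary using (Dec; yes; no; does)
open import Relation.Nullary.Decidable using (dec-true; dec-false)

module _ {X : Set} where

  _↑_ : Rel X 0ℓ → X → Rel X 0ℓ
  (R ↑ a) y z = R y z ⊎ R a y

  -- Almost-full relations, inductively (Vytiniotis, Coquand and Wahlstedt): the constructive
  -- form of "every infinite sequence has i < j with R (f i) (f j)", see AF⇒good.
  data AF : Rel X 0ℓ → Set₁ where
    now   : ∀ {R} → (∀ x y → R x y) → AF R
    later : ∀ {R} → (∀ a → AF (R ↑ a)) → AF R

  ↑-mono : ∀ {R S : Rel X 0ℓ} → R ⇒ S → ∀ a → R ↑ a ⇒ S ↑ a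
  ↑-mono R⇒S a (inj₁ r) = inj₁ (R⇒S r)
  ↑-mono R⇒S a (inj₂ r) = inj₂ (R⇒S r)

  AF-mono : ∀ {R S : Rel X 0ℓ} → R ⇒ S → AF R → AF S
  AF-mono R⇒S (now r)   = now λ x y → R⇒S (r x y)
  AF-mono {R} {S} R⇒S (later r) = later λ a → AF-mono (↑-mono {R} {S} R⇒S a) (r a)

  AF⇒good : ∀ {R} → AF R → (f : ℕ → X) → Σ ℕ λ i → Σ ℕ λ j → i < j × R (f i) (f j)
  AF⇒good (now r)   f = 0 , 1 , s≤s z≤n , r (f 0) (f 1)
  AF⇒good (later r) f with AF⇒good (r (f 0)) (f ∘ suc)
  ... | i , j , i<j , inj₁ r = suc i , suc j , s≤s i<j , r
  ... | i , j , i<j , inj₂ r = 0 , suc i , s≤s z≤n , r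

  private
    Unary : (X → Set) → Rel X 0ℓ
    Unary A x _ = A x

    ∪-× : ∀ {P A B : Set} → P ⊎ A → P ⊎ B → P ⊎ (A × B)
    ∪-× (inj₁ p) _        = inj₁ p
    ∪-× (inj₂ a) (inj₁ p) = inj₁ p
    ∪-× (inj₂ a) (inj₂ b) = inj₂ (a , b)

    ⊎-swapʳ : ∀ {A B C : Set} → (A ⊎ B) ⊎ C → (A ⊎ C) ⊎ B
    ⊎-swapʳ (inj₁ (inj₁ a)) = inj₁ (inj₁ a)
    ⊎-swapʳ (inj₁ (inj₂ b)) = inj₂ b
    ⊎-swapʳ (inj₂ c)        = inj₁ (inj₂ c)

    ↑-∪ : ∀ {S P C : Rel X 0ℓ} → S ⇒ P ∪ C → ∀ a → S ↑ a ⇒ ((P ↑ a) ∪ (λ y _ → C a y)) ∪ C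
    ↑-∪ h a (inj₁ s) = map₁ (inj₁ ∘′ inj₁) (h s)
    ↑-∪ h a (inj₂ s) = inj₁ (map₁ inj₂ (h s))

    ∪-↑ : ∀ {P C : Rel X 0ℓ} a → ((P ↑ a) ∪ C) ∪ (λ y _ → C a y) ⇒ (P ∪ C) ↑ a
    ∪-↑ a (inj₁ (inj₁ (inj₁ p))) = inj₁ (inj₁ p)
    ∪-↑ a (inj₁ (inj₁ (inj₂ p))) = inj₂ (inj₁ p)
    ∪-↑ a (inj₁ (inj₂ c))        = inj₁ (inj₂ c)
    ∪-↑ a (inj₂ c)               = inj₂ (inj₂ c)

  -- Closure under intersection, through residuals A, B of arity 0, 1 and 2; each arity's step
  -- needs the previous one for the residual A a. Relations S below P ∪ A are carried along
  -- instead of P ∪ A itself so that the recursion on AF S stays structural.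
  AF-∪-×₀ : ∀ {S S' P : Rel X 0ℓ} {A B : Set} → AF S → AF S' →
            S ⇒ P ∪ Const A → S' ⇒ P ∪ Const B → AF (P ∪ Const (A × B))
  AF-∪-×₀ (now s) (now s') h h' = now λ x y → ∪-× (h (s x y)) (h' (s' x y))
  AF-∪-×₀ {P = P} (later s) q h h' = later λ a → AF-mono (λ r → ∪-↑ {P} a (inj₁ r))
    (AF-∪-×₀ (s a) q (λ where (inj₁ t) → map₁ inj₁ (h t) ; (inj₂ t) → map₁ inj₂ (h t))
                     (map₁ inj₁ ∘′ h'))
  AF-∪-×₀ {P = P} (now s) (later s') h h' = later λ a → AF-mono (λ r → ∪-↑ {P} a (inj₁ r))
    (AF-∪-×₀ (now s) (s' a) (map₁ inj₁ ∘′ h)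
                            (λ where (inj₁ t) → map₁ inj₁ (h' t) ; (inj₂ t) → map₁ inj₂ (h' t)))

  AF-∪-×₁ : ∀ {S S' P : Rel X 0ℓ} {A B : X → Set} → AF S → AF S' →
            S ⇒ P ∪ Unary A → S' ⇒ P ∪ Unary B → AF (P ∪ Unary (λ x → A x × B x))
  AF-∪-×₁ {S} {S'} {P} {A} {B} p q h h' = later λ a →
    AF-mono (∪-↑ {P} {Unary AB} a) (AF-∪-×₀ (left p a) (right q a) ⊎-swapʳ ⊎-swapʳ)
    where
    AB : X → Set
    AB x = A x × B x
    left : AF S → ∀ a → AF (((P ↑ a) ∪ Const (A a)) ∪ Unary AB)
    left (now s)   a = now λ y _ → inj₁ (map₁ inj₂ (h (s a y)))
    left (later s) a = AF-∪-×₁ (s a) q (↑-∪ {S} {P} {Unary A} h a) (map₁ (inj₁ ∘′ inj₁) ∘′ h')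
    right : AF S' → ∀ a → AF (((P ↑ a) ∪ Const (B a)) ∪ Unary AB)
    right (now s')   a = now λ y _ → inj₁ (map₁ inj₂ (h' (s' a y)))
    right (later s') a = AF-∪-×₁ p (s' a) (map₁ (inj₁ ∘′ inj₁) ∘′ h) (↑-∪ {S'} {P} {Unary B} h' a)

  AF-∪-∩ : ∀ {S S' P A B : Rel X 0ℓ} → AF S → AF S' →
           S ⇒ P ∪ A → S' ⇒ P ∪ B → AF (P ∪ (A ∩ B))
  AF-∪-∩ {S} {S'} {P} {A} {B} p q h h' = later λ a →
    AF-mono (∪-↑ {P} {A ∩ B} a) (AF-∪-×₁ (left p a) (right q a) ⊎-swapʳ ⊎-swapʳ)
    where
    left : AF S → ∀ a → AF (((P ↑ a) ∪ Unary (A a)) ∪ (A ∩ B))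
    left (now s)   a = now λ y _ → inj₁ (map₁ inj₂ (h (s a y)))
    left (later s) a = AF-∪-∩ (s a) q (↑-∪ {S} {P} {A} h a) (map₁ (inj₁ ∘′ inj₁) ∘′ h')
    right : AF S' → ∀ a → AF (((P ↑ a) ∪ Unary (B a)) ∪ (A ∩ B))
    right (now s')   a = now λ y _ → inj₁ (map₁ inj₂ (h' (s' a y)))
    right (later s') a = AF-∪-∩ p (s' a) (map₁ (inj₁ ∘′ inj₁) ∘′ h) (↑-∪ {S'} {P} {B} h' a)

  AF-∩ : ∀ {R T : Rel X 0ℓ} → AF R → AF T → AF (R ∩ T)
  AF-∩ p q = AF-mono (λ where (inj₂ rt) → rt) (AF-∪-∩ {P = Never} p q inj₂ inj₂)

AF-comap : ∀ {X Y : Set} {R : Rel Y 0ℓ} (g : X → Y) → AF R → AF (R on g)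
AF-comap g (now r)   = now λ x y → r (g x) (g y)
AF-comap g (later r) = later λ a → AF-comap g (r (g a))

AF-≤ : AF _≤_
AF-≤ = later AF-≤↑
  where
  AF-≤↑ : ∀ a → AF (_≤_ ↑ a)
  AF-≤↑ zero    = now λ _ _ → inj₂ z≤n
  AF-≤↑ (suc a) = later λ b → by-cases b (b ≤? a)
    where
    by-cases : ∀ b → Dec (b ≤ a) → AF ((_≤_ ↑ suc a) ↑ b)
    by-cases b (no b≰a)  = now λ _ _ → inj₂ (inj₂ (≰⇒> b≰a))
    by-cases b (yes b≤a) = AF-mono (λ where (inj₁ y≤z) → inj₁ (inj₁ y≤z)
                                            (inj₂ a≤y) → inj₂ (inj₁ (≤-trans b≤a a≤y)))
                                   (AF-≤↑ a)

SameResidue≤ : (q : ℕ) .{{_ : NonZero q}} → Rel ℕ 0ℓ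
SameResidue≤ q a b = a / q ≤ b / q × a % q ≡ b % q

-- The residues lie below q, where q ∸_ reverses ≤, so two ≤-comparisons give equality.
AF-SameResidue≤ : ∀ q .{{_ : NonZero q}} → AF (SameResidue≤ q)
AF-SameResidue≤ q = AF-mono same-residue
  (AF-∩ (AF-comap (_/ q) AF-≤) (AF-∩ (AF-comap (_% q) AF-≤) (AF-comap (λ a → q ∸ a % q) AF-≤)))
  where
  same-residue : (_≤_ on (_/ q)) ∩ ((_≤_ on (_% q)) ∩ (_≤_ on (λ a → q ∸ a % q))) ⇒ SameResidue≤ q
  same-residue {a} {b} (quot , rem , rem′) = quot , ≤-antisym rem (∸-cancelʳ-≤ (<⇒≤ (m%n<n b q)) rem′)

SameResidue≤⇒≡+* : ∀ q .{{_ : NonZero q}} {a b} → SameResidue≤ q a b → b ≡ a + (b / q ∸ a / q) * q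
SameResidue≤⇒≡+* q {a} {b} (quot , rem) = begin
  b                                     ≡⟨ m≡m%n+[m/n]*n b q ⟩
  b % q + b / q * q                     ≡⟨ cong₂ (λ r t → r + t * q) (≡.sym rem) (≡.sym (m+[n∸m]≡n quot)) ⟩
  a % q + (a / q + (b / q ∸ a / q)) * q ≡⟨ cong (a % q +_) (*-distribʳ-+ q (a / q) _) ⟩
  a % q + (a / q * q + (b / q ∸ a / q) * q) ≡⟨ ≡.sym (+-assoc (a % q) _ _) ⟩
  a % q + a / q * q + (b / q ∸ a / q) * q ≡⟨ cong (_+ (b / q ∸ a / q) * q) (≡.sym (m≡m%n+[m/n]*n a q)) ⟩
  a + (b / q ∸ a / q) * q               ∎
  where open ≡-Reasoning

count : ℕ → List ℕ → ℕ
count d xs = length (filter (d ≟_) xs)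

count-++ : ∀ d xs ys → count d (xs ++ ys) ≡ count d xs + count d ys
count-++ d xs ys = trans (cong length (filter-++ (d ≟_) xs ys)) (length-++ (filter (d ≟_) xs))

count-↭ : ∀ {xs ys} → xs ↭ ys → ∀ d → count d xs ≡ count d ys
count-↭ p d = ↭-length (filter-↭ (d ≟_) p)

count-≡0 : ∀ {d xs} → All (d ≢_) xs → count d xs ≡ 0
count-≡0 {d} d∉xs = cong length (filter-none (d ≟_) d∉xs)

count-all : ∀ {d xs} → All (d ≡_) xs → count d xs ≡ length xs
count-all {d} all-d = cong length (filter-all (d ≟_) all-d)

count-∷-self : ∀ x xs → count x (x ∷ xs) ≡ suc (count x xs)
count-∷-self x xs = cong length (filter-accept (x ≟_) refl)

count-∷-other : ∀ {x y} xs → x ≢ y → count x (y ∷ xs) ≡ count x xs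
count-∷-other xs x≢y = cong length (filter-reject (_ ≟_) x≢y)

count-above : ∀ {k e xs} → All (_≤ k) xs → k < e → count e xs ≡ 0
count-above xs≤k k<e = count-≡0 (All.map (λ x≤k e≡x → <⇒≢ (≤-<-trans x≤k k<e) (≡.sym e≡x)) xs≤k)

count-pos⇒↭∷ : ∀ {x} ys → 0 < count x ys → Σ (List ℕ) λ zs → ys ↭ x ∷ zs
count-pos⇒↭∷ {x} (y ∷ ys) pos with x ≟ y
... | yes refl = ys , ↭-refl
... | no x≢y with count-pos⇒↭∷ ys (subst (0 <_) (count-∷-other ys x≢y) pos)
...   | zs , ys↭x∷zs = y ∷ zs , ↭-trans (↭-prep y ys↭x∷zs) (↭-swap y x ↭-refl)

counts⇒↭ : ∀ xs ys → (∀ d → count d xs ≡ count d ys) → xs ↭ ys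
counts⇒↭ [] []       _    = ↭-refl
counts⇒↭ [] (y ∷ ys) same = ⊥-elim (0≢1+n (trans (same y) (count-∷-self y ys)))
counts⇒↭ (x ∷ xs) ys same
  with zs , ys↭x∷zs ← count-pos⇒↭∷ ys (subst (0 <_) (trans (≡.sym (count-∷-self x xs)) (same x)) (s≤s z≤n))
  = ↭-trans (↭-prep x (counts⇒↭ xs zs same-tail)) (↭-sym ys↭x∷zs)
  where
  same-tail : ∀ d → count d xs ≡ count d zs
  same-tail d = +-cancelˡ-≡ (count d [ x ]) _ _ (begin
    count d [ x ] + count d xs ≡⟨ ≡.sym (count-++ d [ x ] xs) ⟩
    count d (x ∷ xs)           ≡⟨ same d ⟩
    count d ys                 ≡⟨ count-↭ ys↭x∷zs d ⟩
    count d (x ∷ zs)           ≡⟨ count-++ d [ x ] zs ⟩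
    count d [ x ] + count d zs ∎)
    where open ≡-Reasoning

trues : ∀ {n} → (Fin n → Bool) → ℕ
trues {zero}  b = 0
trues {suc n} b = if b zero then suc (trues (b ∘ suc)) else trues (b ∘ suc)

trues-cong : ∀ {n} {b c : Fin n → Bool} → b ≗ c → trues b ≡ trues c
trues-cong {zero}  b≗c = refl
trues-cong {suc n} b≗c rewrite b≗c zero = cong (λ t → if _ then suc t else t) (trues-cong (b≗c ∘ suc))

trues-false : ∀ n → trues {n} (λ _ → false) ≡ 0
trues-false zero    = refl
trues-false (suc n) = trues-false n

trues-true : ∀ n → trues {n} (λ _ → true) ≡ n
trues-true zero    = refl
trues-true (suc n) = cong suc (trues-true n)

trues-↑ : ∀ m {n} (b : Fin (m + n) → Bool) → trues b ≡ trues (b ∘ (_↑ˡ n)) + trues (b ∘ (m ↑ʳ_))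
trues-↑ zero    b = refl
trues-↑ (suc m) b with b zero
... | true  = cong suc (trues-↑ m (b ∘ suc))
... | false = trues-↑ m (b ∘ suc)

length-filter-tabulate : ∀ {A : Set} {n} (p : A → Bool) (f : Fin n → A) →
                         length (filter (T? ∘ p) (tabulate f)) ≡ trues (p ∘ f)
length-filter-tabulate {n = zero}  p f = refl
length-filter-tabulate {n = suc n} p f with p (f zero)
... | true  = cong suc (length-filter-tabulate p (f ∘ suc))
... | false = length-filter-tabulate p (f ∘ suc)

tabulate-↑ : ∀ {A : Set} m {n} (f : Fin (m + n) → A) →
             tabulate f ≡ tabulate (f ∘ (_↑ˡ n)) ++ tabulate (f ∘ (m ↑ʳ_))
tabulate-↑ zero    f = refl
tabulate-↑ (suc m) f = cong (f zero ∷_) (tabulate-↑ m (f ∘ suc))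

degree-trues : ∀ {n} (G : Graph n) v → degree G v ≡ trues (adj G v)
degree-trues G v = length-filter-tabulate (adj G v) id

degrees-tabulate : ∀ {n} (G : Graph n) → degrees G ≡ tabulate (degree G)
degrees-tabulate G = map-tabulate id (degree G)

length-degrees : ∀ {n} (G : Graph n) → length (degrees G) ≡ n
length-degrees {n} G = trans (length-map (degree G) (tabulate id)) (length-tabulate id)

regular⇒degrees : ∀ {n d} (G : Graph n) → (∀ v → degree G v ≡ d) → All (d ≡_) (degrees G)
regular⇒degrees G regular = subst (All _) (≡.sym (degrees-tabulate G)) (tabulate⁺ (≡.sym ∘ regular))

module _ {m n} (G : Graph m) (F : Graph n) where

  private
    adj⊎ : Fin m ⊎ Fin n → Fin m ⊎ Fin n → Bool
    adj⊎ (inj₁ u) (inj₁ v) = adj G u v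
    adj⊎ (inj₂ u) (inj₂ v) = adj F u v
    adj⊎ (inj₁ _) (inj₂ _) = false
    adj⊎ (inj₂ _) (inj₁ _) = false

    adj⊎-sym : ∀ s t → adj⊎ s t ≡ adj⊎ t s
    adj⊎-sym (inj₁ u) (inj₁ v) = Graph.sym G u v
    adj⊎-sym (inj₂ u) (inj₂ v) = Graph.sym F u v
    adj⊎-sym (inj₁ _) (inj₂ _) = refl
    adj⊎-sym (inj₂ _) (inj₁ _) = refl

    adj⊎-irrefl : ∀ s → adj⊎ s s ≡ false
    adj⊎-irrefl (inj₁ u) = irrefl G u
    adj⊎-irrefl (inj₂ u) = irrefl F u

  _⊕_ : Graph (m + n)
  _⊕_ = record
    { adj    = λ u v → adj⊎ (splitAt m u) (splitAt m v)
    ; sym    = λ u v → adj⊎-sym (splitAt m u) (splitAt m v)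
    ; irrefl = λ u → adj⊎-irrefl (splitAt m u)
    }

  ⊕-adjˡˡ : ∀ u v → adj _⊕_ (u ↑ˡ n) (v ↑ˡ n) ≡ adj G u v
  ⊕-adjˡˡ u v rewrite splitAt-↑ˡ m u n | splitAt-↑ˡ m v n = refl

  ⊕-adjˡʳ : ∀ u v → adj _⊕_ (u ↑ˡ n) (m ↑ʳ v) ≡ false
  ⊕-adjˡʳ u v rewrite splitAt-↑ˡ m u n | splitAt-↑ʳ m n v = refl

  ⊕-adjʳˡ : ∀ u v → adj _⊕_ (m ↑ʳ u) (v ↑ˡ n) ≡ false
  ⊕-adjʳˡ u v rewrite splitAt-↑ʳ m n u | splitAt-↑ˡ m v n = refl

  ⊕-adjʳʳ : ∀ u v → adj _⊕_ (m ↑ʳ u) (m ↑ʳ v) ≡ adj F u v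
  ⊕-adjʳʳ u v rewrite splitAt-↑ʳ m n u | splitAt-↑ʳ m n v = refl

  degree-⊕ˡ : ∀ u → degree _⊕_ (u ↑ˡ n) ≡ degree G u
  degree-⊕ˡ u = begin
    degree _⊕_ (u ↑ˡ n)                                         ≡⟨ degree-trues _⊕_ (u ↑ˡ n) ⟩
    trues (adj _⊕_ (u ↑ˡ n))                                     ≡⟨ trues-↑ m _ ⟩
    trues (adj _⊕_ (u ↑ˡ n) ∘ (_↑ˡ n)) + trues (adj _⊕_ (u ↑ˡ n) ∘ (m ↑ʳ_))
      ≡⟨ cong₂ _+_ (trues-cong (⊕-adjˡˡ u)) (trans (trues-cong (⊕-adjˡʳ u)) (trues-false n)) ⟩
    trues (adj G u) + 0                                          ≡⟨ +-identityʳ _ ⟩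
    trues (adj G u)                                              ≡⟨ degree-trues G u ⟨
    degree G u                                                   ∎
    where open ≡-Reasoning

  degree-⊕ʳ : ∀ u → degree _⊕_ (m ↑ʳ u) ≡ degree F u
  degree-⊕ʳ u = begin
    degree _⊕_ (m ↑ʳ u)                                          ≡⟨ degree-trues _⊕_ (m ↑ʳ u) ⟩
    trues (adj _⊕_ (m ↑ʳ u))                                     ≡⟨ trues-↑ m _ ⟩
    trues (adj _⊕_ (m ↑ʳ u) ∘ (_↑ˡ n)) + trues (adj _⊕_ (m ↑ʳ u) ∘ (m ↑ʳ_))
      ≡⟨ cong₂ _+_ (trans (trues-cong (⊕-adjʳˡ u)) (trues-false m)) (trues-cong (⊕-adjʳʳ u)) ⟩
    trues (adj F u)                                              ≡⟨ degree-trues F u ⟨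
    degree F u                                                   ∎
    where open ≡-Reasoning

  degrees-⊕ : degrees _⊕_ ≡ degrees G ++ degrees F
  degrees-⊕ = begin
    degrees _⊕_                                          ≡⟨ degrees-tabulate _⊕_ ⟩
    tabulate (degree _⊕_)                                ≡⟨ tabulate-↑ m (degree _⊕_) ⟩
    tabulate (degree _⊕_ ∘ (_↑ˡ n)) ++ tabulate (degree _⊕_ ∘ (m ↑ʳ_))
      ≡⟨ cong₂ _++_ (tabulate-cong degree-⊕ˡ) (tabulate-cong degree-⊕ʳ) ⟩
    tabulate (degree G) ++ tabulate (degree F)           ≡⟨ cong₂ _++_ (degrees-tabulate G) (degrees-tabulate F) ⟨
    degrees G ++ degrees F                               ∎
    where open ≡-Reasoning

  ⊕-inducedˡ : InducedSubgraph G _⊕_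
  ⊕-inducedˡ = (_↑ˡ n) , ↑ˡ-injective n _ _ , λ u v → ≡.sym (⊕-adjˡˡ u v)

complete : ∀ n → Graph n
complete n = record
  { adj    = λ u v → not (does (u ≟ᶠ v))
  ; sym    = λ u v → cong not (≟ᶠ-sym u v)
  ; irrefl = λ u → cong not (dec-true (u ≟ᶠ u) refl)
  }
  where
  ≟ᶠ-sym : ∀ (u v : Fin n) → does (u ≟ᶠ v) ≡ does (v ≟ᶠ u)
  ≟ᶠ-sym u v with u ≟ᶠ v
  ... | yes refl = ≡.sym (dec-true (u ≟ᶠ u) refl)
  ... | no u≢v   = ≡.sym (dec-false (v ≟ᶠ u) (u≢v ∘ ≡.sym))

degree-complete : ∀ n (v : Fin (suc n)) → degree (complete (suc n)) v ≡ n
degree-complete n v = trans (degree-trues (complete (suc n)) v) (trues-others n v)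
  where
  trues-others : ∀ n (v : Fin (suc n)) → trues (λ u → not (does (v ≟ᶠ u))) ≡ n
  trues-others n       zero    = trues-true n
  trues-others (suc n) (suc v) = cong suc (trues-others n v)

cliques : ∀ d t → Graph (t * suc d)
cliques d zero    = complete 0
cliques d (suc t) = complete (suc d) ⊕ cliques d t

degrees-cliques : ∀ d t → All (d ≡_) (degrees (cliques d t))
degrees-cliques d zero    = All.[]
degrees-cliques d (suc t) = subst (All (d ≡_)) (≡.sym (degrees-⊕ (complete (suc d)) (cliques d t)))
  (++⁺ (regular⇒degrees (complete (suc d)) (degree-complete d)) (degrees-cliques d t))

count-degrees-⊕ : ∀ {m n} (G : Graph m) (F : Graph n) e →
                  count e (degrees (G ⊕ F)) ≡ count e (degrees G) + count e (degrees F)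
count-degrees-⊕ G F e = trans (cong (count e) (degrees-⊕ G F)) (count-++ e (degrees G) (degrees F))

count-cliques-self : ∀ d t → count d (degrees (cliques d t)) ≡ t * suc d
count-cliques-self d t = trans (count-all (degrees-cliques d t)) (length-degrees (cliques d t))

count-cliques-other : ∀ {e} d t → e ≢ d → count e (degrees (cliques d t)) ≡ 0
count-cliques-other d t e≢d =
  count-≡0 (All.map (λ d≡x e≡x → e≢d (trans e≡x (≡.sym d≡x))) (degrees-cliques d t))

paddingOrder : (ℕ → ℕ) → ℕ → ℕ
paddingOrder t zero    = 0
paddingOrder t (suc d) = paddingOrder t d + t d * suc d

padding : ∀ t n → Graph (paddingOrder t n)
padding t zero    = complete 0
padding t (suc d) = padding t d ⊕ cliques d (t d)

count-padding-≥ : ∀ t {n e} → n ≤ e → count e (degrees (padding t n)) ≡ 0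
count-padding-≥ t {zero}      _   = refl
count-padding-≥ t {suc n} {e} n<e = begin
  count e (degrees (padding t (suc n)))                               ≡⟨ count-degrees-⊕ (padding t n) _ e ⟩
  count e (degrees (padding t n)) + count e (degrees (cliques n (t n)))
    ≡⟨ cong₂ _+_ (count-padding-≥ t (<⇒≤ n<e)) (count-cliques-other n (t n) (≡.≢-sym (<⇒≢ n<e))) ⟩
  0                                                                   ∎
  where open ≡-Reasoning

count-padding-< : ∀ t {n e} → e < n → count e (degrees (padding t n)) ≡ t e * suc e
count-padding-< t {suc n} {e} e<1+n = trans (count-degrees-⊕ (padding t n) _ e) (by-cases (m<1+n⇒m<n∨m≡n e<1+n))
  where
  by-cases : e < n ⊎ e ≡ n → count e (degrees (padding t n)) + count e (degrees (cliques n (t n))) ≡ t e * suc e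
  by-cases (inj₁ e<n) = trans (cong₂ _+_ (count-padding-< t e<n) (count-cliques-other n (t n) (<⇒≢ e<n))) (+-identityʳ _)
  by-cases (inj₂ refl) = cong₂ _+_ (count-padding-≥ t {e} ≤-refl) (count-cliques-self e (t e))

⪯-by-counts : ∀ {m n} (G : Graph m) (F : Graph n) {xs ys} → Realizes G xs → Linked _≥_ ys →
              (∀ e → count e ys ≡ count e xs + count e (degrees F)) → xs ⪯ ys
⪯-by-counts {m} {n} G F {xs} {ys} (xs-sorted , xs↭) ys-sorted counts =
  m , m + n , G , G ⊕ F , (xs-sorted , xs↭) , (ys-sorted , ys↭) , ⊕-inducedˡ G F
  where
  ys↭ : ys ↭ degrees (G ⊕ F)
  ys↭ = counts⇒↭ ys (degrees (G ⊕ F)) λ e → begin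
    count e ys                                    ≡⟨ counts e ⟩
    count e xs + count e (degrees F)              ≡⟨ cong (_+ count e (degrees F)) (count-↭ xs↭ e) ⟩
    count e (degrees G) + count e (degrees F)     ≡⟨ count-degrees-⊕ G F e ⟨
    count e (degrees (G ⊕ F))                     ∎
    where open ≡-Reasoning

-- ys is xs plus, for each e < n, a multiple of e + 1 further entries e.
ExtendsByCliques : ℕ → Rel (List ℕ) 0ℓ
ExtendsByCliques n xs ys = ∀ e → e < n → SameResidue≤ (suc e) (count e xs) (count e ys)

AF-ExtendsByCliques : ∀ n → AF (ExtendsByCliques n)
AF-ExtendsByCliques zero    = now λ _ _ _ ()
AF-ExtendsByCliques (suc n) = AF-mono (λ {xs} {ys} → extend {xs} {ys})
  (AF-∩ (AF-ExtendsByCliques n) (AF-comap (count n) (AF-SameResidue≤ (suc n))))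
  where
  extend : ExtendsByCliques n ∩ (SameResidue≤ (suc n) on count n) ⇒ ExtendsByCliques (suc n)
  extend (below , at-n) e e<1+n with m<1+n⇒m<n∨m≡n e<1+n
  ... | inj₁ e<n  = below e e<n
  ... | inj₂ refl = at-n

cliqueCounts : List ℕ → List ℕ → ℕ → ℕ
cliqueCounts xs ys e = count e ys / suc e ∸ count e xs / suc e

count-padding-cliqueCounts : ∀ k {xs ys} → All (_≤ k) xs → All (_≤ k) ys → ExtendsByCliques (suc k) xs ys →
  ∀ e → count e ys ≡ count e xs + count e (degrees (padding (cliqueCounts xs ys) (suc k)))
count-padding-cliqueCounts k {xs} {ys} xs≤k ys≤k extends e with e <? suc k
... | yes e<1+k = trans (SameResidue≤⇒≡+* (suc e) {count e xs} {count e ys} (extends e e<1+k))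
                      (cong (count e xs +_) (≡.sym (count-padding-< (cliqueCounts xs ys) e<1+k)))
... | no  e≮1+k = begin
  count e ys                                                           ≡⟨ count-above ys≤k k<e ⟩
  0 + 0                                                                ≡⟨ cong₂ _+_ (count-above xs≤k k<e)
                                                                              (count-padding-≥ (cliqueCounts xs ys) k<e) ⟨
  count e xs + count e (degrees (padding (cliqueCounts xs ys) (suc k))) ∎
  where
  open ≡-Reasoning
  k<e : k < e
  k<e = ≮⇒≥ e≮1+k

corollary3 : (k : ℕ) → (D : ℕ → List ℕ) →
    (∀ i → IsDegreeSequence (D i) × All (λ d → d ≤ k) (D i)) →
    Σ ℕ λ i → Σ ℕ λ j → i < j × D i ⪯ D j
corollary3 k D degree-sequences =
  let i , j , i<j , extends            = AF⇒good (AF-ExtendsByCliques (suc k)) D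
      (_ , Gᵢ , Gᵢ-realizes) , Dᵢ≤k    = degree-sequences i
      (_ , _ , Dⱼ-sorted , _) , Dⱼ≤k   = degree-sequences j
  in i , j , i<j , ⪯-by-counts Gᵢ (padding (cliqueCounts (D i) (D j)) (suc k)) Gᵢ-realizes Dⱼ-sorted
                                  (count-padding-cliqueCounts k Dᵢ≤k Dⱼ≤k extends)
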